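{- Let $p \geq 5$ be a prime. For $j \in \mathbb{F}_p$ let $f_j(x) = x^2 - 2(j+1)x + (j-1)^2$, and for $k \in \mathbb{F}_p$ let $$\epsilon_k = \sum_{x=0}^{p-1} \left(\frac{f_1(x) f_k(x)}{p}\right).$$ Then $\epsilon_1 = p - 2$ and $\epsilon_9 = -1 - \left(\frac{p}{3}\right)$ (where $9$ is taken modulo $p$).
   Context: $\left(\frac{a}{p}\right)$ denotes the Legendre symbol modulo $p$, with $\left(\frac{0}{p}\right) = 0$; $\left(\frac{p}{3}\right)$ is the Legendre symbol of $p$ modulo $3$. -}

module Defs where

open import Data.Nat as ℕ using (ℕ; zero; suc; NonZero)
open import Data.Nat.DivMod as ℕD using ()
open import Data.Integer as ℤ using (ℤ; +_; -_; _%ℕ_; 0ℤ; 1ℤ; -1ℤ)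
open import Data.List using (List; upTo; map)
open import Data.Bool.ListAction using (any)
open import Data.Bool using (Bool; true; false; if_then_else_)
open import Relation.Nullary.Decidable using (⌊_⌋)

isSquareMod : (p : ℕ) .{{_ : NonZero p}} → ℕ → Bool
isSquareMod p r = any (λ x → ⌊ ((x ℕ.* x) ℕD.% p) ℕ.≟ r ⌋) (upTo p)

legendre : ℤ → (p : ℕ) .{{_ : NonZero p}} → ℤ
legendre a p with a %ℕ p
... | zero = 0ℤ
... | r@(suc _) = if isSquareMod p r then 1ℤ else -1ℤ

f : ℤ → ℤ → ℤ
f j x = x ℤ.* x ℤ.- (+ 2) ℤ.* (j ℤ.+ 1ℤ) ℤ.* x ℤ.+ (j ℤ.- 1ℤ) ℤ.* (j ℤ.- 1ℤ)

sumℤ : List ℤ → ℤ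
sumℤ = Data.List.foldr ℤ._+_ 0ℤ

ε : (p : ℕ) .{{_ : NonZero p}} → ℤ → ℤ
ε p k = sumℤ (map (λ x → legendre (f (+ 1) (+ x) ℤ.* f k (+ x)) p) (upTo p))

module Submission where

-- Since f₁ = x (x - 4), the summand of ε₁ is the square (f₁(x)/p)², which is 1 except at
-- the two roots 0 and 4; hence ε₁ = p - 2.  Since f₁ f₉ = (x - 4)² x (x - 16), dropping
-- the square factor gives ε₉ = Σ (x(x - 16)/p) - (4·(-12)/p) = -1 - (-3/p), using
-- Σ_x (x(x - a)/p) = -1 for a ≢ 0 (substitute x ↦ 1/x to make the sum affine).  Finally
-- (-3/p) = (p/3): x ↦ 1/(1 - x) has order 3 on 𝔽_p ∖ {0, 1}, and its fixed points are the
-- roots of x² - x + 1, i.e. of (2x - 1)² = -3, of which there are 1 + (-3/p).  The other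
-- points fall into 3-cycles, so p - 3 - (-3/p) ≡ 0 (mod 3).

open import Defs
open import Data.Nat as ℕ using (ℕ; zero; suc; _<_; _≤_; _≥_; _∸_; z≤n; s≤s; NonZero)
import Data.Nat.Properties as ℕ
open import Data.Nat.Primality using (Prime; prime⇒nonZero; prime⇒nonTrivial; euclidsLemma)
open import Data.Nat.Coprimality using (prime⇒coprime; coprime-Bézout)
open import Data.Nat.GCD using (module Bézout)
open import Data.Integer as ℤ using (ℤ; +_; -_; _+_; _*_; _-_; 0ℤ; 1ℤ; -1ℤ; _%ℕ_; _/ℕ_)
open import Data.Integer.DivMod using (a≡a%ℕn+[a/ℕn]*n; n%ℕd<d)
import Data.Integer.Properties as ℤ
open import Data.Integer.Tactic.RingSolver using (solve-∀)
open import Data.List using (upTo; applyUpTo; map)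
open import Data.List.Relation.Unary.Any using (satisfied)
open import Data.List.Relation.Unary.Any.Properties using (any⁺; any⁻)
open import Data.List.Membership.Propositional using (lose)
open import Data.List.Membership.Propositional.Properties using (∈-upTo⁺)
open import Data.Bool using (true; false; T; if_then_else_)
open import Data.Product using (_×_; _,_; ∃; proj₁; proj₂)
open import Data.Empty using (⊥-elim)
open import Data.Sum using (_⊎_; inj₁; inj₂; [_,_]′)
import Data.Sum
open import Relation.Nullary using (¬_; Dec; yes; no)
open import Relation.Nullary.Decidable using (toSum; toWitness; fromWitness; toWitnessFalse)
open import Data.Integer.Divisibility.Signed
  using (_∣_; _∣?_; divides; ∣-refl; ∣m∣n⇒∣m+n; ∣n⇒∣m*n; ∣m⇒∣m*n; ∣m+n∣n⇒∣m; ∣⇒∣ᵤ; ∣ᵤ⇒∣)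
import Data.Nat.DivMod as ℕ
import Data.Nat.Divisibility as ℕ
open import Relation.Binary.PropositionalEquality
open import Function using (_∘_; id)
open import Relation.Binary.Definitions using (tri<; tri≈; tri>)

∑< : ℕ → (ℕ → ℤ) → ℤ
∑< zero    g = 0ℤ
∑< (suc n) g = ∑< n g + g n

syntax ∑< n (λ x → e) = ∑[ x < n ] e

δ : ℕ → ℕ → ℤ
δ x a with x ℕ.≟ a
... | yes _ = 1ℤ
... | no  _ = 0ℤ

δ-refl : ∀ x → δ x x ≡ 1ℤ
δ-refl x with x ℕ.≟ x
... | yes _  = refl
... | no x≢x = ⊥-elim (x≢x refl)

δ-≢ : ∀ {x a} → x ≢ a → δ x a ≡ 0ℤ
δ-≢ {x} {a} x≢a with x ℕ.≟ a
... | yes x≡a = ⊥-elim (x≢a x≡a)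
... | no  _   = refl

∑-cong : ∀ n {g h : ℕ → ℤ} → (∀ x → x < n → g x ≡ h x) → ∑< n g ≡ ∑< n h
∑-cong zero    g≗h = refl
∑-cong (suc n) g≗h =
  cong₂ _+_ (∑-cong n (λ x x<n → g≗h x (ℕ.m<n⇒m<1+n x<n))) (g≗h n ℕ.≤-refl)

∑-+ : ∀ n (g h : ℕ → ℤ) → ∑[ x < n ] (g x + h x) ≡ ∑< n g + ∑< n h
∑-+ zero    g h = refl
∑-+ (suc n) g h = trans (cong (_+ (g n + h n)) (∑-+ n g h)) (swap (∑< n g) (∑< n h) (g n) (h n))
  where
  swap : ∀ a b c d → (a + b) + (c + d) ≡ (a + c) + (b + d)
  swap = solve-∀

∑-- : ∀ n (g h : ℕ → ℤ) → ∑[ x < n ] (g x - h x) ≡ ∑< n g - ∑< n h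
∑-- zero    g h = refl
∑-- (suc n) g h = trans (cong (_+ (g n - h n)) (∑-- n g h)) (swap (∑< n g) (∑< n h) (g n) (h n))
  where
  swap : ∀ a b c d → (a - b) + (c - d) ≡ (a + c) - (b + d)
  swap = solve-∀

∑-const : ∀ n c → ∑[ x < n ] c ≡ + n * c
∑-const zero    c = sym (ℤ.*-zeroˡ c)
∑-const (suc n) c = trans (cong (_+ c) (∑-const n c)) (step (+ n) c)
  where
  step : ∀ m c → m * c + c ≡ (1ℤ + m) * c
  step = solve-∀

∑-comm : ∀ n m (h : ℕ → ℕ → ℤ) → ∑[ x < n ] ∑[ y < m ] h x y ≡ ∑[ y < m ] ∑[ x < n ] h x y
∑-comm n zero    h = trans (∑-const n 0ℤ) (ℤ.*-zeroʳ (+ n))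
∑-comm n (suc m) h =
  trans (∑-+ n (λ x → ∑< m (h x)) (λ x → h x m)) (cong (_+ ∑< n (λ x → h x m)) (∑-comm n m h))

∑-zero : ∀ n {g : ℕ → ℤ} → (∀ x → x < n → g x ≡ 0ℤ) → ∑< n g ≡ 0ℤ
∑-zero n g≗0 = trans (∑-cong n g≗0) (trans (∑-const n 0ℤ) (ℤ.*-zeroʳ (+ n)))

∑-δ : ∀ n a (g : ℕ → ℤ) → a < n → ∑[ x < n ] (δ x a * g x) ≡ g a
∑-δ (suc n) a g a<1+n with a ℕ.≟ n
... | yes refl = begin
  ∑[ x < n ] (δ x a * g x) + δ a a * g a  ≡⟨ cong₂ _+_ (∑-zero n below) (cong (_* g a) (δ-refl a)) ⟩
  0ℤ + 1ℤ * g a                          ≡⟨ trans (ℤ.+-identityˡ _) (ℤ.*-identityˡ _) ⟩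
  g a                                    ∎
  where
  open ≡-Reasoning
  below : ∀ x → x < a → δ x a * g x ≡ 0ℤ
  below x x<a = trans (cong (_* g x) (δ-≢ (ℕ.<⇒≢ x<a))) (ℤ.*-zeroˡ (g x))
... | no a≢n = begin
  ∑[ x < n ] (δ x a * g x) + δ n a * g n  ≡⟨ cong₂ _+_ (∑-δ n a g a<n) (cong (_* g n) (δ-≢ (a≢n ∘ sym))) ⟩
  g a + 0ℤ * g n                         ≡⟨ cong (λ z → g a + z) (ℤ.*-zeroˡ (g n)) ⟩
  g a + 0ℤ                               ≡⟨ ℤ.+-identityʳ (g a) ⟩
  g a                                    ∎
  where
  open ≡-Reasoning
  a<n = ℕ.≤∧≢⇒< (ℕ.≤-pred a<1+n) a≢n

∑-δ₁ : ∀ n a → a < n → ∑[ x < n ] δ x a ≡ 1ℤ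
∑-δ₁ n a a<n = trans (∑-cong n (λ x _ → sym (ℤ.*-identityʳ (δ x a)))) (∑-δ n a (λ _ → 1ℤ) a<n)

∑-reindex : ∀ n (σ τ : ℕ → ℕ) (g : ℕ → ℤ) →
            (∀ x → x < n → σ x < n) → (∀ y → y < n → τ y < n) →
            (∀ x → x < n → τ (σ x) ≡ x) → (∀ y → y < n → σ (τ y) ≡ y) →
            ∑[ x < n ] g (σ x) ≡ ∑< n g
∑-reindex n σ τ g σ< τ< τσ στ = begin
  ∑[ x < n ] g (σ x)                          ≡⟨ ∑-cong n (λ x x<n → sym (∑-δ n (σ x) g (σ< x x<n))) ⟩
  ∑[ x < n ] ∑[ y < n ] (δ y (σ x) * g y)     ≡⟨ ∑-comm n n (λ x y → δ y (σ x) * g y) ⟩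
  ∑[ y < n ] ∑[ x < n ] (δ y (σ x) * g y)
    ≡⟨ ∑-cong n (λ y y<n → ∑-cong n (λ x x<n → cong (_* g y) (δ-transpose x<n y<n))) ⟩
  ∑[ y < n ] ∑[ x < n ] (δ x (τ y) * g y)
    ≡⟨ ∑-cong n (λ y y<n → ∑-δ n (τ y) (λ _ → g y) (τ< y y<n)) ⟩
  ∑< n g                                      ∎
  where
  open ≡-Reasoning
  δ-transpose : ∀ {x y} → x < n → y < n → δ y (σ x) ≡ δ x (τ y)
  δ-transpose {x} {y} x<n y<n with y ℕ.≟ σ x | x ℕ.≟ τ y
  ... | yes _    | yes _    = refl
  ... | no  _    | no  _    = refl
  ... | yes y≡σx | no  x≢τy = ⊥-elim (x≢τy (trans (sym (τσ x x<n)) (cong τ (sym y≡σx))))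
  ... | no  y≢σx | yes x≡τy = ⊥-elim (y≢σx (trans (sym (στ y y<n)) (cong σ (sym x≡τy))))

∑-suc : ∀ n (g : ℕ → ℤ) → ∑< (suc n) g ≡ g 0 + ∑[ x < n ] g (suc x)
∑-suc zero    g = ℤ.+-comm 0ℤ (g 0)
∑-suc (suc n) g = trans (cong (_+ g (suc n)) (∑-suc n g)) (ℤ.+-assoc (g 0) _ _)

sumℤ-map-applyUpTo : ∀ n (g : ℕ → ℤ) f → sumℤ (map g (applyUpTo f n)) ≡ ∑[ x < n ] g (f x)
sumℤ-map-applyUpTo zero    g f = refl
sumℤ-map-applyUpTo (suc n) g f =
  trans (cong (λ s → g (f 0) + s) (sumℤ-map-applyUpTo n g (f ∘ suc))) (sym (∑-suc n (g ∘ f)))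

sumℤ-map-upTo : ∀ n (g : ℕ → ℤ) → sumℤ (map g (upTo n)) ≡ ∑< n g
sumℤ-map-upTo n g = sumℤ-map-applyUpTo n g id

isMin3 : ℕ → ℕ → ℕ → ℤ
isMin3 a b c with a ℕ.<? b | a ℕ.<? c
... | yes _ | yes _ = 1ℤ
... | _     | _     = 0ℤ

isMin3-yes : ∀ {a b c} → a < b → a < c → isMin3 a b c ≡ 1ℤ
isMin3-yes {a} {b} {c} a<b a<c with a ℕ.<? b | a ℕ.<? c
... | yes _ | yes _   = refl
... | yes _ | no  a≮c = ⊥-elim (a≮c a<c)
... | no a≮b | _      = ⊥-elim (a≮b a<b)

isMin3-no : ∀ {a b c} → b < a ⊎ c < a → isMin3 a b c ≡ 0ℤ
isMin3-no {a} {b} {c} b<a⊎c<a with a ℕ.<? b | a ℕ.<? c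
... | yes a<b | yes a<c = ⊥-elim ([ ℕ.<-asym a<b , ℕ.<-asym a<c ]′ b<a⊎c<a)
... | yes _   | no  _   = refl
... | no  _   | _       = refl

isMin3-rotate : ∀ {a b c} → a ≢ b → a ≢ c → b ≢ c →
                isMin3 a b c + isMin3 b c a + isMin3 c a b ≡ 1ℤ
isMin3-rotate {a} {b} {c} a≢b a≢c b≢c with ℕ.<-cmp a b | ℕ.<-cmp a c | ℕ.<-cmp b c
... | tri≈ _ a≡b _ | _ | _ = ⊥-elim (a≢b a≡b)
... | _ | tri≈ _ a≡c _ | _ = ⊥-elim (a≢c a≡c)
... | _ | _ | tri≈ _ b≡c _ = ⊥-elim (b≢c b≡c)
... | tri< a<b _ _ | tri< a<c _ _ | _ =
  cong₂ _+_ (cong₂ _+_ (isMin3-yes a<b a<c) (isMin3-no {b} {c} (inj₂ a<b))) (isMin3-no {c} {a} (inj₁ a<c))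
... | tri> _ _ b<a | _ | tri< b<c _ _ =
  cong₂ _+_ (cong₂ _+_ (isMin3-no {a} {b} (inj₁ b<a)) (isMin3-yes b<c b<a)) (isMin3-no {c} {a} (inj₂ b<c))
... | _ | tri> _ _ c<a | tri> _ _ c<b =
  cong₂ _+_ (cong₂ _+_ (isMin3-no {a} {b} (inj₂ c<a)) (isMin3-no {b} {c} (inj₁ c<b))) (isMin3-yes c<a c<b)
... | tri< a<b _ _ | tri> _ _ c<a | tri< b<c _ _ = ⊥-elim (ℕ.<-irrefl refl (ℕ.<-trans a<b (ℕ.<-trans b<c c<a)))
... | tri> _ _ b<a | tri< a<c _ _ | tri> _ _ c<b = ⊥-elim (ℕ.<-irrefl refl (ℕ.<-trans b<a (ℕ.<-trans a<c c<b)))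

module _ (n : ℕ) (σ : ℕ → ℕ) (σ< : ∀ x → x < n → σ x < n)
         (σ³≡id : ∀ x → x < n → σ (σ (σ x)) ≡ x) where

  private
    moved : ℕ → ℤ
    moved x = 1ℤ - δ (σ x) x

    -- each 3-cycle of σ contributes exactly once, at its least element
    orbitMin : ℕ → ℤ
    orbitMin x = moved x * isMin3 x (σ x) (σ (σ x))

    moved-fixed : ∀ {x} → σ x ≡ x → moved x ≡ 0ℤ
    moved-fixed {x} σx≡x = cong (_-_ 1ℤ) (trans (cong (λ y → δ y x) σx≡x) (δ-refl x))

    moved-moving : ∀ {x} → σ x ≢ x → moved x ≡ 1ℤ
    moved-moving σx≢x = cong (_-_ 1ℤ) (δ-≢ σx≢x)

    orbit-fixed : ∀ {x} → σ x ≡ x → moved x ≡ orbitMin x + orbitMin (σ x) + orbitMin (σ (σ x))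
    orbit-fixed {x} σx≡x =
      trans (moved-fixed σx≡x)
            (sym (zeros (moved-fixed σx≡x) (moved-fixed (cong σ σx≡x)) (moved-fixed (cong (σ ∘ σ) σx≡x))))
      where
      zeros : ∀ {u v w a b c} → u ≡ 0ℤ → v ≡ 0ℤ → w ≡ 0ℤ → u * a + v * b + w * c ≡ 0ℤ
      zeros {a = a} {b} {c} refl refl refl = cong₂ _+_ (cong₂ _+_ (ℤ.*-zeroˡ a) (ℤ.*-zeroˡ b)) (ℤ.*-zeroˡ c)

    orbit-moving : ∀ {x} → x < n → σ x ≢ x → moved x ≡ orbitMin x + orbitMin (σ x) + orbitMin (σ (σ x))
    orbit-moving {x} x<n σx≢x = begin
      moved x
        ≡⟨ moved-moving σx≢x ⟩
      1ℤ
        ≡⟨ isMin3-rotate (σx≢x ∘ sym) (z≢x ∘ sym) (z≢y ∘ sym) ⟨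
      isMin3 x y z + isMin3 y z x + isMin3 z x y
        ≡⟨ cong₂ _+_ (cong₂ _+_ (minimal x σx≢x refl) (minimal y z≢y (cong (isMin3 y z) x≡σz)))
                     (minimal z σz≢z (cong₂ (isMin3 z) x≡σz (cong σ x≡σz))) ⟩
      orbitMin x + orbitMin y + orbitMin z
        ∎
      where
      open ≡-Reasoning
      y = σ x
      z = σ y
      x≡σz : x ≡ σ z
      x≡σz = sym (σ³≡id x x<n)
      z≢y : z ≢ y
      z≢y z≡y = σx≢x (trans (sym (trans (cong σ z≡y) z≡y)) (sym x≡σz))
      z≢x : z ≢ x
      z≢x z≡x = σx≢x (trans (sym (cong σ z≡x)) (sym x≡σz))
      σz≢z : σ z ≢ z
      σz≢z σz≡z = z≢x (trans (sym σz≡z) (sym x≡σz))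
      minimal : ∀ u → σ u ≢ u → ∀ {m} → m ≡ isMin3 u (σ u) (σ (σ u)) → m ≡ orbitMin u
      minimal u σu≢u m≡ = trans (sym (ℤ.*-identityˡ _)) (cong₂ _*_ (sym (moved-moving σu≢u)) m≡)

  3∣n-#fixed : + 3 ∣ (+ n - ∑[ x < n ] δ (σ x) x)
  3∣n-#fixed = divides (∑< n orbitMin) (begin
    + n - ∑[ x < n ] δ (σ x) x
      ≡⟨ cong (_- ∑[ x < n ] δ (σ x) x) (trans (sym (ℤ.*-identityʳ (+ n))) (sym (∑-const n 1ℤ))) ⟩
    ∑[ x < n ] 1ℤ - ∑[ x < n ] δ (σ x) x
      ≡⟨ ∑-- n (λ _ → 1ℤ) (λ x → δ (σ x) x) ⟨
    ∑< n moved
      ≡⟨ ∑-cong n (λ x x<n → [ orbit-fixed , orbit-moving x<n ]′ (toSum (σ x ℕ.≟ x))) ⟩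
    ∑[ x < n ] (orbitMin x + orbitMin (σ x) + orbitMin (σ (σ x)))
      ≡⟨ trans (∑-+ n _ _) (cong₂ _+_ (∑-+ n orbitMin (orbitMin ∘ σ)) refl) ⟩
    ∑< n orbitMin + ∑[ x < n ] orbitMin (σ x) + ∑[ x < n ] orbitMin (σ (σ x))
      ≡⟨ cong₂ _+_ (cong (_+_ (∑< n orbitMin)) (∑-reindex n σ (σ ∘ σ) orbitMin σ< σ²< σ³≡id σ³≡id))
                   (∑-reindex n (σ ∘ σ) σ orbitMin σ²< σ< σ³≡id σ³≡id) ⟩
    ∑< n orbitMin + ∑< n orbitMin + ∑< n orbitMin
      ≡⟨ thrice (∑< n orbitMin) ⟩
    ∑< n orbitMin * + 3
      ∎)
    where
    open ≡-Reasoning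
    σ²< : ∀ x → x < n → σ (σ x) < n
    σ²< x x<n = σ< (σ x) (σ< x x<n)
    thrice : ∀ a → a + a + a ≡ a * + 3
    thrice = solve-∀

module Modular (p : ℕ) (pr : Prime p) where

  instance
    p≢0 : NonZero p
    p≢0 = prime⇒nonZero pr

  0<p : 0 < p
  0<p = ℕ.>-nonZero⁻¹ p

  1<p : 1 < p
  1<p = ℕ.nonTrivial⇒n>1 p {{prime⇒nonTrivial pr}}

  p∣_ : ℤ → Set
  p∣ a = + p ∣ a

  p∣0 : p∣ 0ℤ
  p∣0 = divides 0ℤ refl

  p∣p : p∣ (+ p)
  p∣p = divides 1ℤ (sym (ℤ.*-identityˡ (+ p)))

  p∣? : ∀ a → Dec (p∣ a)
  p∣? a = + p ∣? a

  p∣-lincomb : ∀ {a b c} u v → p∣ a → p∣ b → c ≡ u * a + v * b → p∣ c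
  p∣-lincomb u v p∣a p∣b refl = ∣m∣n⇒∣m+n (∣n⇒∣m*n u p∣a) (∣n⇒∣m*n v p∣b)

  p∣-multiple : ∀ {a c} u → p∣ a → c ≡ u * a → p∣ c
  p∣-multiple u p∣a refl = ∣n⇒∣m*n u p∣a

  p∣-refl : ∀ a → p∣ (a - a)
  p∣-refl a = subst p∣_ (sym (ℤ.+-inverseʳ a)) p∣0

  p∣-sym : ∀ {a b} → p∣ (a - b) → p∣ (b - a)
  p∣-sym {a} {b} p∣a-b = p∣-multiple -1ℤ p∣a-b (flip a b)
    where
    flip : ∀ a b → b - a ≡ -1ℤ * (a - b)
    flip = solve-∀

  p∣-trans : ∀ {a b c} → p∣ (a - b) → p∣ (b - c) → p∣ (a - c)
  p∣-trans {a} {b} {c} p∣a-b p∣b-c = p∣-lincomb 1ℤ 1ℤ p∣a-b p∣b-c (telescope a b c)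
    where
    telescope : ∀ a b c → a - c ≡ 1ℤ * (a - b) + 1ℤ * (b - c)
    telescope = solve-∀

  p∣nat⇒≡0 : ∀ {d} → d < p → p∣ (+ d) → d ≡ 0
  p∣nat⇒≡0 {d} d<p p∣d =
    trans (sym (ℕ.m<n⇒m%n≡m d<p)) (ℕ.n∣m⇒m%n≡0 d p (∣⇒∣ᵤ {+ p} {+ d} p∣d))

  p∤1 : ¬ p∣ 1ℤ
  p∤1 p∣1 = ℕ.1+n≢0 (p∣nat⇒≡0 1<p p∣1)

  private
    <p-injective-≤ : ∀ {x y} → x ≤ y → y < p → p∣ (+ y - + x) → y ≡ x
    <p-injective-≤ {x} {y} x≤y y<p p∣y-x = ℕ.≤-antisym (ℕ.m∸n≡0⇒m≤n y∸x≡0) x≤y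
      where
      y∸x≡0 : y ∸ x ≡ 0
      y∸x≡0 = p∣nat⇒≡0 (ℕ.≤-<-trans (ℕ.m∸n≤m y x) y<p)
                (subst p∣_ (trans (ℤ.m-n≡m⊖n y x) (ℤ.⊖-≥ x≤y)) p∣y-x)

  <p-injective : ∀ {x y} → x < p → y < p → p∣ (+ x - + y) → x ≡ y
  <p-injective {x} {y} x<p y<p p∣x-y with ℕ.≤-total x y
  ... | inj₁ x≤y = sym (<p-injective-≤ x≤y y<p (p∣-sym {+ x} {+ y} p∣x-y))
  ... | inj₂ y≤x = <p-injective-≤ y≤x x<p p∣x-y

  rem : ℤ → ℕ
  rem a = a %ℕ p

  rem<p : ∀ a → rem a < p
  rem<p a = n%ℕd<d a p

  p∣-rem : ∀ a → p∣ (a - + rem a)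
  p∣-rem a = divides (a /ℕ p) (trans (cong (_- + rem a) (a≡a%ℕn+[a/ℕn]*n a p)) (cancel (+ rem a) (a /ℕ p) (+ p)))
    where
    cancel : ∀ r q m → r + q * m - r ≡ q * m
    cancel = solve-∀

  p∣-rem⁻ : ∀ a → p∣ (+ rem a - a)
  p∣-rem⁻ a = p∣-sym {a} {+ rem a} (p∣-rem a)

  rem-nat : ∀ {x} → x < p → rem (+ x) ≡ x
  rem-nat = ℕ.m<n⇒m%n≡m

  rem-cong : ∀ {a b} → p∣ (a - b) → rem a ≡ rem b
  rem-cong {a} {b} p∣a-b = <p-injective (rem<p a) (rem<p b)
    (p∣-trans {+ rem a} {a} (p∣-rem⁻ a) (p∣-trans {a} {b} p∣a-b (p∣-rem b)))

  rem-cong⁻ : ∀ {a b} → rem a ≡ rem b → p∣ (a - b)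
  rem-cong⁻ {a} {b} ra≡rb =
    p∣-trans {a} {+ rem a} (p∣-rem a) (subst (λ r → p∣ (+ r - b)) (sym ra≡rb) (p∣-rem⁻ b))

  p∣⇒rem≡0 : ∀ {a} → p∣ a → rem a ≡ 0
  p∣⇒rem≡0 {a} p∣a = trans (rem-cong {a} {0ℤ} (subst p∣_ (sym (ℤ.+-identityʳ a)) p∣a)) (rem-nat 0<p)

  rem≡0⇒p∣ : ∀ {a} → rem a ≡ 0 → p∣ a
  rem≡0⇒p∣ {a} ra≡0 = subst p∣_ (ℤ.+-identityʳ a) (rem-cong⁻ {a} {0ℤ} (trans ra≡0 (sym (rem-nat 0<p))))

  p∣*⇒p∣⊎p∣ : ∀ a b → p∣ (a * b) → p∣ a ⊎ p∣ b
  p∣*⇒p∣⊎p∣ a b p∣ab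
    with euclidsLemma ℤ.∣ a ∣ ℤ.∣ b ∣ pr (subst (p ℕ.∣_) (ℤ.abs-* a b) (∣⇒∣ᵤ {+ p} {a * b} p∣ab))
  ... | inj₁ p∣a = inj₁ (∣ᵤ⇒∣ p∣a)
  ... | inj₂ p∣b = inj₂ (∣ᵤ⇒∣ p∣b)

  p∤* : ∀ {a b} → ¬ p∣ a → ¬ p∣ b → ¬ p∣ (a * b)
  p∤* {a} {b} p∤a p∤b p∣ab = [ p∤a , p∤b ]′ (p∣*⇒p∣⊎p∣ a b p∣ab)

  private
    pos-1+m*n : ∀ m n → + (1 ℕ.+ m ℕ.* n) ≡ 1ℤ + + m * + n
    pos-1+m*n m n = trans (ℤ.pos-+ 1 (m ℕ.* n)) (cong (_+_ 1ℤ) (ℤ.pos-* m n))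

    inverse-suc : ∀ {r} → suc r < p → ∃ λ b → p∣ (+ suc r * b - 1ℤ)
    inverse-suc {r} r<p with coprime-Bézout (prime⇒coprime pr r<p)
    ... | Bézout.+- x y 1+yr≡xp = - + y , p∣-multiple (- + x) p∣p (begin
      + suc r * - + y - 1ℤ     ≡⟨ negate (+ y) (+ suc r) ⟩
      - (1ℤ + + y * + suc r)   ≡⟨ cong -_ (pos-1+m*n y (suc r)) ⟨
      - + (1 ℕ.+ y ℕ.* suc r)  ≡⟨ cong (-_ ∘ +_) 1+yr≡xp ⟩
      - + (x ℕ.* p)            ≡⟨ cong -_ (ℤ.pos-* x p) ⟩
      - (+ x * + p)            ≡⟨ ℤ.neg-distribˡ-* (+ x) (+ p) ⟩
      - + x * + p              ∎)
      where
      open ≡-Reasoning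
      negate : ∀ y r → r * - y - 1ℤ ≡ - (1ℤ + y * r)
      negate = solve-∀
    ... | Bézout.-+ x y 1+xp≡yr = + y , p∣-multiple (+ x) p∣p (begin
      + suc r * + y - 1ℤ       ≡⟨ cong (_- 1ℤ) (ℤ.pos-* (suc r) y) ⟨
      + (suc r ℕ.* y) - 1ℤ     ≡⟨ cong (λ n → + n - 1ℤ) (trans (ℕ.*-comm (suc r) y) (sym 1+xp≡yr)) ⟩
      + (1 ℕ.+ x ℕ.* p) - 1ℤ   ≡⟨ cong (_- 1ℤ) (pos-1+m*n x p) ⟩
      1ℤ + + x * + p - 1ℤ      ≡⟨ cancel (+ x * + p) ⟩
      + x * + p                ∎)
      where
      open ≡-Reasoning
      cancel : ∀ t → 1ℤ + t - 1ℤ ≡ t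
      cancel = solve-∀

  inverse : ∀ a → ¬ p∣ a → ∃ λ b → p∣ (a * b - 1ℤ)
  inverse a p∤a with rem a in ra≡
  ... | zero  = ⊥-elim (p∤a (rem≡0⇒p∣ ra≡))
  ... | suc r with inverse-suc (subst (_< p) ra≡ (rem<p a))
  ...   | b , p∣Rb-1 =
    b , p∣-lincomb b 1ℤ (subst (λ t → p∣ (a - + t)) ra≡ (p∣-rem a)) p∣Rb-1 (shift a (+ suc r) b)
    where
    shift : ∀ a R b → a * b - 1ℤ ≡ b * (a - R) + 1ℤ * (R * b - 1ℤ)
    shift = solve-∀

  inverse-unique : ∀ {u v w} → ¬ p∣ u → p∣ (u * v - 1ℤ) → p∣ (u * w - 1ℤ) → p∣ (v - w)
  inverse-unique {u} {v} {w} p∤u p∣uv-1 p∣uw-1 =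
    [ ⊥-elim ∘ p∤u , id ]′ (p∣*⇒p∣⊎p∣ u (v - w) (p∣-lincomb 1ℤ -1ℤ p∣uv-1 p∣uw-1 (difference u v w)))
    where
    difference : ∀ u v w → u * (v - w) ≡ 1ℤ * (u * v - 1ℤ) + -1ℤ * (u * w - 1ℤ)
    difference = solve-∀

  ∑-affine : ∀ c d (g : ℕ → ℤ) → ¬ p∣ c → ∑[ x < p ] g (rem (c * + x + d)) ≡ ∑< p g
  ∑-affine c d g p∤c with c' , p∣cc'-1 ← inverse c p∤c =
    ∑-reindex p σ τ g (λ x _ → rem<p (c * + x + d)) (λ y _ → rem<p (c' * (+ y - d))) τσ στ
    where
    σ τ : ℕ → ℕ
    σ x = rem (c * + x + d)
    τ y = rem (c' * (+ y - d))
    τσ : ∀ x → x < p → τ (σ x) ≡ x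
    τσ x x<p = <p-injective (rem<p (c' * (+ σ x - d))) x<p
      (p∣-trans {+ τ (σ x)} {c' * (+ σ x - d)} (p∣-rem⁻ (c' * (+ σ x - d)))
      (p∣-trans {c' * (+ σ x - d)} {c' * c * + x}
        (p∣-multiple (- c') (p∣-rem (c * + x + d)) (cancel-d c c' (+ σ x) (+ x) d))
        (p∣-multiple (+ x) p∣cc'-1 (cancel-unit c c' (+ x)))))
      where
      cancel-d : ∀ c c' s x d → c' * (s - d) - c' * c * x ≡ - c' * (c * x + d - s)
      cancel-d = solve-∀
      cancel-unit : ∀ c c' x → c' * c * x - x ≡ x * (c * c' - 1ℤ)
      cancel-unit = solve-∀
    στ : ∀ y → y < p → σ (τ y) ≡ y
    στ y y<p = <p-injective (rem<p (c * + τ y + d)) y<p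
      (p∣-trans {+ σ (τ y)} {c * + τ y + d} (p∣-rem⁻ (c * + τ y + d))
      (p∣-trans {c * + τ y + d} {c * c' * (+ y - d) + d}
        (p∣-multiple (- c) (p∣-rem (c' * (+ y - d))) (cancel-d c c' (+ τ y) (+ y) d))
        (p∣-multiple (+ y - d) p∣cc'-1 (cancel-unit c c' (+ y) d))))
      where
      cancel-d : ∀ c c' t y d → c * t + d - (c * c' * (y - d) + d) ≡ - c * (c' * (y - d) - t)
      cancel-d = solve-∀
      cancel-unit : ∀ c c' y d → c * c' * (y - d) + d - y ≡ (y - d) * (c * c' - 1ℤ)
      cancel-unit = solve-∀

  𝟙₀ : ℤ → ℤ
  𝟙₀ a with p∣? a
  ... | yes _ = 1ℤ
  ... | no  _ = 0ℤ

  𝟙₀-p∣ : ∀ {a} → p∣ a → 𝟙₀ a ≡ 1ℤ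
  𝟙₀-p∣ {a} p∣a with p∣? a
  ... | yes _   = refl
  ... | no  p∤a = ⊥-elim (p∤a p∣a)

  𝟙₀-p∤ : ∀ {a} → ¬ p∣ a → 𝟙₀ a ≡ 0ℤ
  𝟙₀-p∤ {a} p∤a with p∣? a
  ... | yes p∣a = ⊥-elim (p∤a p∣a)
  ... | no  _   = refl

  𝟙₀-cong : ∀ {a b} → p∣ (a - b) → 𝟙₀ a ≡ 𝟙₀ b
  𝟙₀-cong {a} {b} p∣a-b with p∣? a | p∣? b
  ... | yes _   | yes _   = refl
  ... | no  _   | no  _   = refl
  ... | yes p∣a | no  p∤b = ⊥-elim (p∤b (p∣-lincomb 1ℤ -1ℤ p∣a p∣a-b (right a b)))
    where
    right : ∀ a b → b ≡ 1ℤ * a + -1ℤ * (a - b)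
    right = solve-∀
  ... | no  p∤a | yes p∣b = ⊥-elim (p∤a (p∣-lincomb 1ℤ 1ℤ p∣a-b p∣b (left a b)))
    where
    left : ∀ a b → a ≡ 1ℤ * (a - b) + 1ℤ * b
    left = solve-∀

  𝟙₀-roots : ∀ {x a b} → x < p → a < p → b < p → a ≢ b →
             𝟙₀ ((+ x - + a) * (+ x - + b)) ≡ δ x a + δ x b
  𝟙₀-roots {x} {a} {b} x<p a<p b<p a≢b with p∣? ((+ x - + a) * (+ x - + b))
  ... | no p∤ = sym (cong₂ _+_ (δ-≢ {x} {a} (λ { refl → p∤ (∣m⇒∣m*n (+ x - + b) (p∣-refl (+ x))) }))
                               (δ-≢ {x} {b} (λ { refl → p∤ (∣n⇒∣m*n (+ x - + a) (p∣-refl (+ x))) })))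
  ... | yes p∣ with p∣*⇒p∣⊎p∣ (+ x - + a) (+ x - + b) p∣
  ...   | inj₁ p∣x-a with refl ← <p-injective x<p a<p p∣x-a = sym (cong₂ _+_ (δ-refl a) (δ-≢ a≢b))
  ...   | inj₂ p∣x-b with refl ← <p-injective x<p b<p p∣x-b = sym (cong₂ _+_ (δ-≢ (a≢b ∘ sym)) (δ-refl b))

  𝟙₀-rem : ∀ a {t} → t < p → 𝟙₀ (a - + t) ≡ δ t (rem a)
  𝟙₀-rem a {t} t<p = [ is-rem , is-not-rem ]′ (toSum (t ℕ.≟ rem a))
    where
    is-rem : t ≡ rem a → 𝟙₀ (a - + t) ≡ δ t (rem a)
    is-rem refl = trans (𝟙₀-p∣ (p∣-rem a)) (sym (δ-refl t))
    is-not-rem : t ≢ rem a → 𝟙₀ (a - + t) ≡ δ t (rem a)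
    is-not-rem t≢ra = trans (𝟙₀-p∤ (t≢ra ∘ t≡rem)) (sym (δ-≢ {t} {rem a} t≢ra))
      where
      t≡rem : p∣ (a - + t) → t ≡ rem a
      t≡rem p∣a-t = trans (sym (rem-nat t<p)) (sym (rem-cong {a} {+ t} p∣a-t))

  𝟙₀-*-p∤ : ∀ {c} a → ¬ p∣ c → 𝟙₀ (c * a) ≡ 𝟙₀ a
  𝟙₀-*-p∤ {c} a p∤c with p∣? a
  ... | yes p∣a = 𝟙₀-p∣ (∣n⇒∣m*n c p∣a)
  ... | no  p∤a = 𝟙₀-p∤ (p∤* p∤c p∤a)

  private
    legendreᵣ : ℕ → ℤ
    legendreᵣ zero        = 0ℤ
    legendreᵣ r@(suc _) = if isSquareMod p r then 1ℤ else -1ℤ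

    legendre≡legendreᵣ : ∀ a → legendre a p ≡ legendreᵣ (rem a)
    legendre≡legendreᵣ a with a %ℕ p
    ... | zero  = refl
    ... | suc _ = refl

  legendre-cong : ∀ {a b} → p∣ (a - b) → legendre a p ≡ legendre b p
  legendre-cong {a} {b} p∣a-b =
    trans (legendre≡legendreᵣ a) (trans (cong legendreᵣ (rem-cong {a} {b} p∣a-b)) (sym (legendre≡legendreᵣ b)))

  legendre-p∣ : ∀ {a} → p∣ a → legendre a p ≡ 0ℤ
  legendre-p∣ {a} p∣a = trans (legendre≡legendreᵣ a) (cong legendreᵣ (p∣⇒rem≡0 p∣a))

  IsSquare : ℤ → Set
  IsSquare a = ∃ λ y → p∣ (y * y - a)

  legendre-cases : ∀ a → ¬ p∣ a → IsSquare a × legendre a p ≡ 1ℤ ⊎ ¬ IsSquare a × legendre a p ≡ -1ℤ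
  legendre-cases a p∤a with rem a in ra≡
  ... | zero = ⊥-elim (p∤a (rem≡0⇒p∣ ra≡))
  ... | suc r with isSquareMod p (suc r) in isSq
  ...   | true  = inj₁ (square , refl)
    where
    square : IsSquare a
    square with x , x²≡r ← satisfied (any⁻ _ (upTo p) (subst T (sym isSq) _)) =
      + x , rem-cong⁻ {+ x * + x} {a} (trans (cong rem (sym (ℤ.pos-* x x))) (trans (toWitness x²≡r) (sym ra≡)))
  ...   | false = inj₂ (nonSquare , refl)
    where
    nonSquare : ¬ IsSquare a
    nonSquare (y , p∣y²-a) = subst T isSq (any⁺ _ (lose (∈-upTo⁺ (rem<p y)) (fromWitness x²≡r)))
      where
      x = rem y
      p∣x²-y² : p∣ (+ x * + x - y * y)
      p∣x²-y² = p∣-multiple (+ x + y) (p∣-rem⁻ y) (squares (+ x) y)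
        where
        squares : ∀ x y → x * x - y * y ≡ (x + y) * (x - y)
        squares = solve-∀
      x²≡r : (x ℕ.* x) ℕ.% p ≡ suc r
      x²≡r = trans (cong rem (ℤ.pos-* x x))
                   (trans (rem-cong {+ x * + x} {a} (p∣-trans {+ x * + x} {y * y} p∣x²-y² p∣y²-a)) ra≡)

  private
    square-scale : ∀ c {t} → IsSquare t → IsSquare (c * c * t)
    square-scale c {t} (y , p∣y²-t) = c * y , p∣-multiple (c * c) p∣y²-t (scale c y t)
      where
      scale : ∀ c y t → c * y * (c * y) - c * c * t ≡ c * c * (y * y - t)
      scale = solve-∀

    square-unscale : ∀ {c t} → ¬ p∣ c → IsSquare (c * c * t) → IsSquare t
    square-unscale {c} {t} p∤c (z , p∣z²-c²t) with d , p∣cd-1 ← inverse c p∤c =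
      z * d , p∣-lincomb (d * d) (t * (c * d + 1ℤ)) p∣z²-c²t p∣cd-1 (unscale c d z t)
      where
      unscale : ∀ c d z t → z * d * (z * d) - t ≡ d * d * (z * z - c * c * t) + t * (c * d + 1ℤ) * (c * d - 1ℤ)
      unscale = solve-∀

    legendre-by-squareness : ∀ {a b} → ¬ p∣ a → ¬ p∣ b →
                             (IsSquare a → IsSquare b) → (IsSquare b → IsSquare a) →
                             legendre a p ≡ legendre b p
    legendre-by-squareness {a} {b} p∤a p∤b a⇒b b⇒a with legendre-cases a p∤a | legendre-cases b p∤b
    ... | inj₁ (_ , ≡1)      | inj₁ (_ , ≡1')      = trans ≡1 (sym ≡1')
    ... | inj₂ (_ , ≡-1)     | inj₂ (_ , ≡-1')     = trans ≡-1 (sym ≡-1')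
    ... | inj₁ (sq-a , _)    | inj₂ (nonsq-b , _)  = ⊥-elim (nonsq-b (a⇒b sq-a))
    ... | inj₂ (nonsq-a , _) | inj₁ (sq-b , _)     = ⊥-elim (nonsq-a (b⇒a sq-b))

  legendre-square-* : ∀ c t → ¬ p∣ c → legendre (c * c * t) p ≡ legendre t p
  legendre-square-* c t p∤c with p∣? t
  ... | yes p∣t = trans (legendre-p∣ (∣n⇒∣m*n (c * c) p∣t)) (sym (legendre-p∣ p∣t))
  ... | no  p∤t = legendre-by-squareness (p∤* (p∤* p∤c p∤c) p∤t) p∤t (square-unscale p∤c) (square-scale c)

  legendre-1 : legendre 1ℤ p ≡ 1ℤ
  legendre-1 with legendre-cases 1ℤ p∤1
  ... | inj₁ (_ , ≡1)       = ≡1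
  ... | inj₂ (nonsquare , _) = ⊥-elim (nonsquare (1ℤ , p∣0))

  legendre-square : ∀ a → legendre (a * a) p ≡ 1ℤ - 𝟙₀ a
  legendre-square a with p∣? a
  ... | yes p∣a = legendre-p∣ (∣n⇒∣m*n a p∣a)
  ... | no  p∤a = trans (cong (λ s → legendre s p) (sym (ℤ.*-identityʳ (a * a))))
                        (trans (legendre-square-* a 1ℤ p∤a) legendre-1)

  inv : ℕ → ℕ
  inv x with p∣? (+ x)
  ... | yes _   = 0
  ... | no  p∤x = rem (proj₁ (inverse (+ x) p∤x))

  inv<p : ∀ x → inv x < p
  inv<p x with p∣? (+ x)
  ... | yes _   = 0<p
  ... | no  p∤x = rem<p (proj₁ (inverse (+ x) p∤x))

  inv-0 : inv 0 ≡ 0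
  inv-0 with p∣? 0ℤ
  ... | yes _ = refl
  ... | no  p∤0 = ⊥-elim (p∤0 p∣0)

  inv-inverse : ∀ {x} → x < p → x ≢ 0 → p∣ (+ x * + inv x - 1ℤ)
  inv-inverse {x} x<p x≢0 with p∣? (+ x)
  ... | yes p∣x = ⊥-elim (x≢0 (p∣nat⇒≡0 x<p p∣x))
  ... | no  p∤x with b , p∣xb-1 ← inverse (+ x) p∤x =
    p∣-lincomb 1ℤ (- + x) p∣xb-1 (p∣-rem b) (shift (+ x) b (+ rem b))
    where
    shift : ∀ x b r → x * r - 1ℤ ≡ 1ℤ * (x * b - 1ℤ) + - x * (b - r)
    shift = solve-∀

  inv≢0 : ∀ {x} → x < p → x ≢ 0 → inv x ≢ 0
  inv≢0 {x} x<p x≢0 invx≡0 =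
    p∤1 (p∣-multiple -1ℤ (subst (λ y → p∣ (+ x * + y - 1ℤ)) invx≡0 (inv-inverse x<p x≢0)) (negate (+ x)))
    where
    negate : ∀ x → 1ℤ ≡ -1ℤ * (x * 0ℤ - 1ℤ)
    negate = solve-∀

  inv-involutive : ∀ x → x < p → inv (inv x) ≡ x
  inv-involutive zero    _   = trans (cong inv inv-0) inv-0
  inv-involutive x@(suc _) x<p =
    <p-injective (inv<p u) x<p (inverse-unique p∤u (inv-inverse (inv<p x) (inv≢0 x<p λ ())) p∣ux-1)
    where
    u = inv x
    p∣ux-1 : p∣ (+ u * + x - 1ℤ)
    p∣ux-1 = subst p∣_ (cong (_- 1ℤ) (ℤ.*-comm (+ x) (+ u))) (inv-inverse x<p λ ())
    p∤u : ¬ p∣ (+ u)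
    p∤u = inv≢0 x<p (λ ()) ∘ p∣nat⇒≡0 (inv<p x)

module OddPrime (p : ℕ) (pr : Prime p) (2<p : 2 < p) where

  open Modular p pr public

  p∤2 : ¬ p∣ (+ 2)
  p∤2 = ℕ.1+n≢0 ∘ p∣nat⇒≡0 2<p

  private
    #sqrt-p∣ : ∀ {t} → p∣ t → ∑[ y < p ] 𝟙₀ (+ y * + y - t) ≡ 1ℤ
    #sqrt-p∣ {t} p∣t = trans (∑-cong p pointwise) (∑-δ₁ p 0 0<p)
      where
      pointwise : ∀ y → y < p → 𝟙₀ (+ y * + y - t) ≡ δ y 0
      pointwise zero    _   = 𝟙₀-p∣ (p∣-multiple -1ℤ p∣t (negate t))
        where
        negate : ∀ t → 0ℤ * 0ℤ - t ≡ -1ℤ * t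
        negate = solve-∀
      pointwise (suc y) y<p = trans (𝟙₀-p∤ p∤y²-t) (sym (δ-≢ {suc y} {0} λ ()))
        where
        Y = + suc y
        p∤Y : ¬ p∣ Y
        p∤Y = ℕ.1+n≢0 ∘ p∣nat⇒≡0 y<p
        p∤y²-t : ¬ p∣ (Y * Y - t)
        p∤y²-t p∣y²-t = p∤* p∤Y p∤Y (p∣-lincomb 1ℤ 1ℤ p∣y²-t p∣t (add-back Y t))
          where
          add-back : ∀ y t → y * y ≡ 1ℤ * (y * y - t) + 1ℤ * t
          add-back = solve-∀

    #sqrt-nonsquare : ∀ {t} → ¬ IsSquare t → ∑[ y < p ] 𝟙₀ (+ y * + y - t) ≡ 0ℤ
    #sqrt-nonsquare nonsquare = ∑-zero p (λ y _ → 𝟙₀-p∤ (λ p∣y²-t → nonsquare (+ y , p∣y²-t)))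

    #sqrt-square : ∀ {t} → ¬ p∣ t → IsSquare t → ∑[ y < p ] 𝟙₀ (+ y * + y - t) ≡ 1ℤ + 1ℤ
    #sqrt-square {t} p∤t (z , p∣z²-t) = begin
      ∑[ y < p ] 𝟙₀ (+ y * + y - t)                   ≡⟨ ∑-cong p (λ y _ → 𝟙₀-cong (factor y)) ⟩
      ∑[ y < p ] 𝟙₀ ((+ y - + y₀) * (+ y - + y₁))     ≡⟨ ∑-cong p (λ y y<p → 𝟙₀-roots y<p (rem<p z) (rem<p (- z)) y₀≢y₁) ⟩
      ∑[ y < p ] (δ y y₀ + δ y y₁)                    ≡⟨ ∑-+ p (λ y → δ y y₀) (λ y → δ y y₁) ⟩
      ∑[ y < p ] δ y y₀ + ∑[ y < p ] δ y y₁           ≡⟨ cong₂ _+_ (∑-δ₁ p y₀ (rem<p z)) (∑-δ₁ p y₁ (rem<p (- z))) ⟩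
      1ℤ + 1ℤ                                         ∎
      where
      open ≡-Reasoning
      y₀ = rem z
      y₁ = rem (- z)
      factor : ∀ y → p∣ ((+ y * + y - t) - (+ y - + y₀) * (+ y - + y₁))
      factor y = p∣-lincomb 1ℤ (+ y - z) (p∣-lincomb 1ℤ (+ y - + y₁) p∣z²-t (p∣-rem⁻ z) refl) (p∣-rem⁻ (- z))
                   (expand (+ y) z t (+ y₀) (+ y₁))
        where
        expand : ∀ y z t y₀ y₁ → (y * y - t) - (y - y₀) * (y - y₁)
                                  ≡ 1ℤ * (1ℤ * (z * z - t) + (y - y₁) * (y₀ - z)) + (y - z) * (y₁ - - z)
        expand = solve-∀
      y₀≢y₁ : y₀ ≢ y₁
      y₀≢y₁ y₀≡y₁ = [ p∤2 , p∤z ]′ (p∣*⇒p∣⊎p∣ (+ 2) z p∣2z)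
        where
        p∣2z : p∣ (+ 2 * z)
        p∣2z = p∣-lincomb -1ℤ 1ℤ (p∣-rem⁻ z) (subst (λ r → p∣ (+ r - - z)) (sym y₀≡y₁) (p∣-rem⁻ (- z)))
                 (double z (+ y₀))
          where
          double : ∀ z r → + 2 * z ≡ -1ℤ * (r - z) + 1ℤ * (r - - z)
          double = solve-∀
        p∤z : ¬ p∣ z
        p∤z p∣z = p∤t (p∣-lincomb -1ℤ z p∣z²-t p∣z (recover z t))
          where
          recover : ∀ z t → t ≡ -1ℤ * (z * z - t) + z * z
          recover = solve-∀

  ∑-𝟙₀-sqrt : ∀ t → ∑[ y < p ] 𝟙₀ (+ y * + y - t) ≡ 1ℤ + legendre t p
  ∑-𝟙₀-sqrt t with p∣? t
  ... | yes p∣t = trans (#sqrt-p∣ p∣t) (sym (cong (_+_ 1ℤ) (legendre-p∣ p∣t)))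
  ... | no  p∤t with legendre-cases t p∤t
  ...   | inj₁ (square , ≡1)     = trans (#sqrt-square p∤t square) (sym (cong (_+_ 1ℤ) ≡1))
  ...   | inj₂ (nonsquare , ≡-1) = trans (#sqrt-nonsquare nonsquare) (sym (cong (_+_ 1ℤ) ≡-1))

  ∑-legendre : ∑[ t < p ] legendre (+ t) p ≡ 0ℤ
  ∑-legendre = begin
    ∑[ t < p ] legendre (+ t) p
      ≡⟨ ∑-cong p (λ t _ → sym (drop-1 (legendre (+ t) p))) ⟩
    ∑[ t < p ] ((1ℤ + legendre (+ t) p) - 1ℤ)
      ≡⟨ ∑-- p _ _ ⟩
    ∑[ t < p ] (1ℤ + legendre (+ t) p) - ∑1
      ≡⟨ cong (_- ∑1) (∑-cong p (λ t _ → sym (∑-𝟙₀-sqrt (+ t)))) ⟩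
    ∑[ t < p ] ∑[ y < p ] 𝟙₀ (+ y * + y - + t) - ∑1
      ≡⟨ cong (_- ∑1) (∑-comm p p (λ t y → 𝟙₀ (+ y * + y - + t))) ⟩
    ∑[ y < p ] ∑[ t < p ] 𝟙₀ (+ y * + y - + t) - ∑1
      ≡⟨ cong (_- ∑1) (∑-cong p (λ y _ → one-root y)) ⟩
    ∑1 - ∑1
      ≡⟨ ℤ.+-inverseʳ ∑1 ⟩
    0ℤ
      ∎
    where
    open ≡-Reasoning
    ∑1 = ∑[ t < p ] 1ℤ
    drop-1 : ∀ l → (1ℤ + l) - 1ℤ ≡ l
    drop-1 = solve-∀
    one-root : ∀ y → ∑[ t < p ] 𝟙₀ (+ y * + y - + t) ≡ 1ℤ
    one-root y = trans (∑-cong p (λ t t<p → 𝟙₀-rem (+ y * + y) t<p)) (∑-δ₁ p _ (rem<p (+ y * + y)))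

  ∑-legendre-affine : ∀ c d → ¬ p∣ c → ∑[ x < p ] legendre (c * + x + d) p ≡ 0ℤ
  ∑-legendre-affine c d p∤c = begin
    ∑[ x < p ] legendre (c * + x + d) p          ≡⟨ ∑-cong p (λ x _ → legendre-cong {c * + x + d} (p∣-rem (c * + x + d))) ⟩
    ∑[ x < p ] legendre (+ rem (c * + x + d)) p  ≡⟨ ∑-affine c d (λ t → legendre (+ t) p) p∤c ⟩
    ∑[ t < p ] legendre (+ t) p                  ≡⟨ ∑-legendre ⟩
    0ℤ                                           ∎
    where open ≡-Reasoning

  ∑-legendre-x[x-a] : ∀ a → ¬ p∣ a → ∑[ x < p ] legendre (+ x * (+ x - a)) p ≡ -1ℤ
  ∑-legendre-x[x-a] a p∤a = begin
    ∑[ x < p ] legendre (+ x * (+ x - a)) p  ≡⟨ ∑-cong p (λ x x<p → pointwise x<p) ⟩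
    ∑[ x < p ] (g (inv x) - δ x 0)           ≡⟨ ∑-- p (g ∘ inv) (λ x → δ x 0) ⟩
    ∑[ x < p ] g (inv x) - ∑[ x < p ] δ x 0  ≡⟨ cong₂ _-_ (∑-reindex p inv inv g (λ x _ → inv<p x) (λ x _ → inv<p x)
                                                                     inv-involutive inv-involutive)
                                                          (∑-δ₁ p 0 0<p) ⟩
    ∑< p g - 1ℤ                              ≡⟨ cong (_- 1ℤ) ∑g≡0 ⟩
    -1ℤ                                      ∎
    where
    open ≡-Reasoning
    g : ℕ → ℤ
    g y = legendre (1ℤ - a * + y) p
    ∑g≡0 : ∑< p g ≡ 0ℤ
    ∑g≡0 = trans (∑-cong p (λ y _ → cong (λ s → legendre s p) (reorder a (+ y))))
                 (∑-legendre-affine (- a) 1ℤ (λ p∣-a → p∤a (p∣-multiple -1ℤ p∣-a (neg-neg a))))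
      where
      reorder : ∀ a y → 1ℤ - a * y ≡ - a * y + 1ℤ
      reorder = solve-∀
      neg-neg : ∀ a → a ≡ -1ℤ * - a
      neg-neg = solve-∀
    pointwise : ∀ {x} → x < p → legendre (+ x * (+ x - a)) p ≡ g (inv x) - δ x 0
    pointwise {zero} _ = begin
      legendre 0ℤ p      ≡⟨ legendre-p∣ p∣0 ⟩
      0ℤ                 ≡⟨ ℤ.+-inverseʳ 1ℤ ⟨
      1ℤ - 1ℤ            ≡⟨ cong₂ _-_ (sym g0≡1) (sym (δ-refl 0)) ⟩
      g 0 - δ 0 0        ≡⟨ cong (λ y → g y - δ 0 0) (sym inv-0) ⟩
      g (inv 0) - δ 0 0  ∎
      where
      g0≡1 : g 0 ≡ 1ℤ
      g0≡1 = trans (legendre-cong {1ℤ - a * 0ℤ} {1ℤ} (p∣-multiple 0ℤ p∣0 (by-zero a))) legendre-1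
        where
        by-zero : ∀ a → 1ℤ - a * 0ℤ - 1ℤ ≡ 0ℤ * 0ℤ
        by-zero = solve-∀
    pointwise {x@(suc _)} x<p = begin
      legendre (+ x * (+ x - a)) p
        ≡⟨ legendre-cong {+ x * (+ x - a)} (p∣-multiple (+ x * a) (inv-inverse x<p λ ()) (factor (+ x) a (+ u))) ⟩
      legendre (+ x * + x * (1ℤ - a * + u)) p
        ≡⟨ legendre-square-* (+ x) (1ℤ - a * + u) (ℕ.1+n≢0 ∘ p∣nat⇒≡0 x<p) ⟩
      g u
        ≡⟨ ℤ.+-identityʳ (g u) ⟨
      g u - 0ℤ
        ≡⟨ cong (λ d → g u - d) (δ-≢ {x} {0} λ ()) ⟨
      g u - δ x 0
        ∎
      where
      u = inv x
      factor : ∀ x a u → x * (x - a) - x * x * (1ℤ - a * u) ≡ x * a * (x * u - 1ℤ)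
      factor = solve-∀

3∣-%3 : ∀ n L → + 3 ∣ (+ n - L) → + 3 ∣ (+ (n ℕ.% 3) - L)
3∣-%3 n L 3∣n-L = ∣m+n∣n⇒∣m (subst (+ 3 ∣_) n-L≡ 3∣n-L) (∣n⇒∣m*n (+ n /ℕ 3) ∣-refl)
  where
  n-L≡ : + n - L ≡ (+ (n ℕ.% 3) - L) + (+ n /ℕ 3) * + 3
  n-L≡ = trans (cong (_- L) (a≡a%ℕn+[a/ℕn]*n (+ n) 3)) (shuffle (+ (n ℕ.% 3)) (+ n /ℕ 3) L)
    where
    shuffle : ∀ r q L → r + q * + 3 - L ≡ (r - L) + q * + 3
    shuffle = solve-∀

legendre-3-from-congruence : ∀ n {L} → L ≡ 1ℤ ⊎ L ≡ -1ℤ → + 3 ∣ (+ n - L) → legendre (+ n) 3 ≡ L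
legendre-3-from-congruence n (inj₁ refl) 3∣n-1 with n ℕ.% 3 | ℕ.m%n<n n 3 | 3∣-%3 n 1ℤ 3∣n-1
... | 0 | _ | 3∣-1 = ⊥-elim (toWitnessFalse {a? = + 3 ∣? _} _ 3∣-1)
... | 1 | _ | _    = refl
... | 2 | _ | 3∣1  = ⊥-elim (toWitnessFalse {a? = + 3 ∣? _} _ 3∣1)
... | suc (suc (suc _)) | s≤s (s≤s (s≤s ())) | _
legendre-3-from-congruence n (inj₂ refl) 3∣n+1 with n ℕ.% 3 | ℕ.m%n<n n 3 | 3∣-%3 n -1ℤ 3∣n+1
... | 0 | _ | 3∣1  = ⊥-elim (toWitnessFalse {a? = + 3 ∣? _} _ 3∣1)
... | 1 | _ | 3∣2  = ⊥-elim (toWitnessFalse {a? = + 3 ∣? _} _ 3∣2)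
... | 2 | _ | _    = refl
... | suc (suc (suc _)) | s≤s (s≤s (s≤s ())) | _

module LegendreMinusThree (p : ℕ) (pr : Prime p) (3<p : 3 < p) where

  open OddPrime p pr (ℕ.<⇒≤ 3<p)

  _↦_ : ℕ → ℕ → Set
  x ↦ y = p∣ ((1ℤ - + x) * + y - 1ℤ)

  p∤1-x : ∀ {x} → 2 ≤ x → x < p → ¬ p∣ (1ℤ - + x)
  p∤1-x {x} 2≤x x<p p∣1-x =
    ℕ.<-irrefl (sym (<p-injective x<p 1<p (p∣-multiple -1ℤ p∣1-x (negate (+ x))))) 2≤x
    where
    negate : ∀ x → x - 1ℤ ≡ -1ℤ * (1ℤ - x)
    negate = solve-∀

  -- x ↦ 1/(1 - x), made to fix 0 and 1 (rather than swap them) so that σ³ = id on [0, p)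
  σ : ℕ → ℕ
  σ 0 = 0
  σ 1 = 1
  σ x@(suc (suc _)) = inv (rem (1ℤ - + x))

  σ<p : ∀ x → x < p → σ x < p
  σ<p 0 0<p = 0<p
  σ<p 1 1<p = 1<p
  σ<p x@(suc (suc _)) _ = inv<p (rem (1ℤ - + x))

  σ-↦ : ∀ {x} → 2 ≤ x → x < p → x ↦ σ x
  σ-↦ {x} 2≤x@(s≤s (s≤s _)) x<p =
    p∣-lincomb 1ℤ (+ u) (inv-inverse (rem<p (1ℤ - + x)) r≢0) (p∣-rem (1ℤ - + x)) (shift (1ℤ - + x) (+ r) (+ u))
    where
    r = rem (1ℤ - + x)
    u = inv r
    r≢0 : r ≢ 0
    r≢0 = p∤1-x 2≤x x<p ∘ rem≡0⇒p∣
    shift : ∀ a r u → a * u - 1ℤ ≡ 1ℤ * (r * u - 1ℤ) + u * (a - r)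
    shift = solve-∀

  ↦-unique : ∀ {x y w} → 2 ≤ x → x < p → y < p → w < p → x ↦ y → x ↦ w → y ≡ w
  ↦-unique 2≤x x<p y<p w<p x↦y x↦w = <p-injective y<p w<p (inverse-unique (p∤1-x 2≤x x<p) x↦y x↦w)

  ↦-≥2 : ∀ {x y} → 2 ≤ x → x < p → x ↦ y → 2 ≤ y
  ↦-≥2 {x} {0} 2≤x x<p x↦0 = ⊥-elim (p∤1 (p∣-multiple -1ℤ x↦0 (at-0 (+ x))))
    where
    at-0 : ∀ x → 1ℤ ≡ -1ℤ * ((1ℤ - x) * 0ℤ - 1ℤ)
    at-0 = solve-∀
  ↦-≥2 {x} {1} 2≤x x<p x↦1 =
    ⊥-elim (ℕ.<⇒≢ (ℕ.<-trans (s≤s z≤n) 2≤x) (sym (p∣nat⇒≡0 x<p (p∣-multiple -1ℤ x↦1 (at-1 (+ x))))))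
    where
    at-1 : ∀ x → x ≡ -1ℤ * ((1ℤ - x) * 1ℤ - 1ℤ)
    at-1 = solve-∀
  ↦-≥2 {y = suc (suc _)} _ _ _ = s≤s (s≤s z≤n)

  σ-≥2 : ∀ {x} → 2 ≤ x → x < p → 2 ≤ σ x
  σ-≥2 2≤x x<p = ↦-≥2 2≤x x<p (σ-↦ 2≤x x<p)

  σ³≡id : ∀ x → x < p → σ (σ (σ x)) ≡ x
  σ³≡id 0 _ = refl
  σ³≡id 1 _ = refl
  σ³≡id x@(suc (suc _)) x<p = ↦-unique 2≤z z<p (σ<p z z<p) x<p (σ-↦ 2≤z z<p) z↦x
    where
    2≤x : 2 ≤ x
    2≤x = s≤s (s≤s z≤n)
    y = σ x
    y<p = σ<p x x<p
    2≤y = σ-≥2 2≤x x<p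
    z = σ y
    z<p = σ<p y y<p
    2≤z = σ-≥2 2≤y y<p
    z↦x : z ↦ x
    z↦x = p∣-lincomb (+ z) (1ℤ - + x) (σ-↦ 2≤x x<p) (σ-↦ 2≤y y<p) (cycle (+ x) (+ y) (+ z))
      where
      cycle : ∀ x y z → (1ℤ - z) * x - 1ℤ ≡ z * ((1ℤ - x) * y - 1ℤ) + (1ℤ - x) * ((1ℤ - y) * z - 1ℤ)
      cycle = solve-∀

  Q : ℕ → ℤ
  Q x = + x * + x - + x + 1ℤ

  δ-σ : ∀ x → x < p → δ (σ x) x ≡ δ x 0 + δ x 1 + 𝟙₀ (Q x)
  δ-σ 0 _ = sym (cong (_+_ 1ℤ) (𝟙₀-p∤ p∤1))
  δ-σ 1 _ = sym (cong (_+_ 1ℤ) (𝟙₀-p∤ p∤1))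
  δ-σ x@(suc (suc _)) x<p with p∣? (Q x)
  ... | yes p∣Qx = trans (cong (λ y → δ y x) σx≡x) (δ-refl x)
    where
    σx≡x : σ x ≡ x
    σx≡x = ↦-unique 2≤x x<p (σ<p x x<p) x<p (σ-↦ 2≤x x<p) (p∣-multiple -1ℤ p∣Qx (negate (+ x)))
      where
      2≤x : 2 ≤ x
      2≤x = s≤s (s≤s z≤n)
      negate : ∀ x → (1ℤ - x) * x - 1ℤ ≡ -1ℤ * (x * x - x + 1ℤ)
      negate = solve-∀
  ... | no p∤Qx = δ-≢ {σ x} {x} σx≢x
    where
    σx≢x : σ x ≢ x
    σx≢x σx≡x = p∤Qx (p∣-multiple -1ℤ (subst (x ↦_) σx≡x (σ-↦ (s≤s (s≤s z≤n)) x<p)) (negate (+ x)))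
      where
      negate : ∀ x → x * x - x + 1ℤ ≡ -1ℤ * ((1ℤ - x) * x - 1ℤ)
      negate = solve-∀

  ∑-𝟙₀-Q : ∑[ x < p ] 𝟙₀ (Q x) ≡ 1ℤ + legendre (- + 3) p
  ∑-𝟙₀-Q = begin
    ∑[ x < p ] 𝟙₀ (Q x)                            ≡⟨ ∑-cong p (λ x _ → sym (𝟙₀-*-p∤ (Q x) (p∤* p∤2 p∤2))) ⟩
    ∑[ x < p ] 𝟙₀ (+ 4 * Q x)                      ≡⟨ ∑-cong p (λ x _ → 𝟙₀-cong (complete-square x)) ⟩
    ∑[ x < p ] h (rem (+ 2 * + x + -1ℤ))           ≡⟨ ∑-affine (+ 2) -1ℤ h p∤2 ⟩
    ∑< p h                                         ≡⟨ ∑-𝟙₀-sqrt (- + 3) ⟩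
    1ℤ + legendre (- + 3) p                        ∎
    where
    open ≡-Reasoning
    h : ℕ → ℤ
    h w = 𝟙₀ (+ w * + w - - + 3)
    complete-square : ∀ x → let w = rem (+ 2 * + x + -1ℤ) in p∣ (+ 4 * Q x - (+ w * + w - - + 3))
    complete-square x = p∣-multiple (+ 2 * + x + -1ℤ + + w) (p∣-rem (+ 2 * + x + -1ℤ)) (identity (+ x) (+ w))
      where
      w = rem (+ 2 * + x + -1ℤ)
      identity : ∀ x w → + 4 * (x * x - x + 1ℤ) - (w * w - - + 3)
                         ≡ (+ 2 * x + -1ℤ + w) * (+ 2 * x + -1ℤ - w)
      identity = solve-∀

  ∑-δ-σ : ∑[ x < p ] δ (σ x) x ≡ + 3 + legendre (- + 3) p
  ∑-δ-σ = begin
    ∑[ x < p ] δ (σ x) x                          ≡⟨ ∑-cong p δ-σ ⟩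
    ∑[ x < p ] (δ x 0 + δ x 1 + 𝟙₀ (Q x))         ≡⟨ ∑-+ p _ _ ⟩
    ∑[ x < p ] (δ x 0 + δ x 1) + ∑[ x < p ] 𝟙₀ (Q x)
                                                  ≡⟨ cong₂ _+_ (trans (∑-+ p _ _) (cong₂ _+_ (∑-δ₁ p 0 0<p) (∑-δ₁ p 1 1<p))) ∑-𝟙₀-Q ⟩
    1ℤ + 1ℤ + (1ℤ + L)                            ≡⟨ ℤ.+-assoc (+ 2) 1ℤ L ⟨
    + 3 + L                                       ∎
    where
    open ≡-Reasoning
    L = legendre (- + 3) p

  legendre-−3 : legendre (- + 3) p ≡ legendre (+ p) 3
  legendre-−3 = sym (legendre-3-from-congruence p ±1 3∣p-L)
    where
    L = legendre (- + 3) p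
    p∤-3 : ¬ p∣ (- + 3)
    p∤-3 p∣-3 = ℕ.1+n≢0 (p∣nat⇒≡0 3<p (p∣-multiple -1ℤ p∣-3 refl))
    ±1 : L ≡ 1ℤ ⊎ L ≡ -1ℤ
    ±1 = Data.Sum.map proj₂ proj₂ (legendre-cases (- + 3) p∤-3)
    3∣p-L : + 3 ∣ (+ p - L)
    3∣p-L = subst (+ 3 ∣_) (trans (cong (λ s → + p - s + + 3) ∑-δ-σ) (shuffle (+ p) L))
              (∣m∣n⇒∣m+n (3∣n-#fixed p σ σ<p σ³≡id) ∣-refl)
      where
      shuffle : ∀ p L → p - (+ 3 + L) + + 3 ≡ p - L
      shuffle = solve-∀

module Epsilon (p : ℕ) (pr : Prime p) (4<p : 4 < p) where

  2<p : 2 < p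
  2<p = ℕ.≤-trans (ℕ.m≤m+n 3 2) 4<p

  open OddPrime p pr 2<p
  open LegendreMinusThree p pr (ℕ.<⇒≤ 4<p) using (legendre-−3)

  p∤4 : ¬ p∣ (+ 4)
  p∤4 = p∤* p∤2 p∤2

  ε-as-∑ : ∀ k → ε p k ≡ ∑[ x < p ] legendre (f (+ 1) (+ x) * f k (+ x)) p
  ε-as-∑ k = sumℤ-map-upTo p _

  f₁ : ∀ X → f (+ 1) X ≡ (X - + 0) * (X - + 4)
  f₁ = identity
    where
    identity : ∀ X → X * X - + 2 * (+ 1 + 1ℤ) * X + (+ 1 - 1ℤ) * (+ 1 - 1ℤ) ≡ (X - + 0) * (X - + 4)
    identity = solve-∀

  f₁f₉ : ∀ X → f (+ 1) X * f (+ 9) X ≡ (X - + 4) * (X - + 4) * (X * (X - + 16))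
  f₁f₉ = identity
    where
    identity : ∀ X → (X * X - + 2 * (+ 1 + 1ℤ) * X + (+ 1 - 1ℤ) * (+ 1 - 1ℤ)) * (X * X - + 2 * (+ 9 + 1ℤ) * X + (+ 9 - 1ℤ) * (+ 9 - 1ℤ))
                     ≡ (X - + 4) * (X - + 4) * (X * (X - + 16))
    identity = solve-∀

  ε₁ : ε p (+ 1) ≡ + (p ∸ 2)
  ε₁ = begin
    ε p (+ 1)
      ≡⟨ ε-as-∑ (+ 1) ⟩
    ∑[ x < p ] legendre (f (+ 1) (+ x) * f (+ 1) (+ x)) p
      ≡⟨ ∑-cong p (λ x _ → legendre-square (f (+ 1) (+ x))) ⟩
    ∑[ x < p ] (1ℤ - 𝟙₀ (f (+ 1) (+ x)))
      ≡⟨ ∑-cong p (λ x x<p → cong (_-_ 1ℤ) (trans (cong 𝟙₀ (f₁ (+ x))) (𝟙₀-roots x<p 0<p 4<p λ ()))) ⟩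
    ∑[ x < p ] (1ℤ - (δ x 0 + δ x 4))
      ≡⟨ ∑-- p _ _ ⟩
    ∑[ x < p ] 1ℤ - ∑[ x < p ] (δ x 0 + δ x 4)
      ≡⟨ cong₂ _-_ (∑-const p 1ℤ) (trans (∑-+ p _ _) (cong₂ _+_ (∑-δ₁ p 0 0<p) (∑-δ₁ p 4 4<p))) ⟩
    + p * 1ℤ - (1ℤ + 1ℤ)
      ≡⟨ minus-2 (ℕ.<⇒≤ 2<p) ⟩
    + (p ∸ 2)
      ∎
    where
    open ≡-Reasoning
    minus-2 : ∀ {n} → 2 ≤ n → + n * 1ℤ - (1ℤ + 1ℤ) ≡ + (n ∸ 2)
    minus-2 {suc (suc k)} (s≤s (s≤s _)) = cancel (+ k)
      where
      cancel : ∀ k → (1ℤ + (1ℤ + k)) * 1ℤ - (1ℤ + 1ℤ) ≡ k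
      cancel = solve-∀

  ε₉ : ε p (+ 9) ≡ -1ℤ - legendre (+ p) 3
  ε₉ = begin
    ε p (+ 9)
      ≡⟨ ε-as-∑ (+ 9) ⟩
    ∑[ x < p ] legendre (f (+ 1) (+ x) * f (+ 9) (+ x)) p
      ≡⟨ ∑-cong p (λ x x<p → remove-double-root x<p) ⟩
    ∑[ x < p ] (legendre (+ x * (+ x - + 16)) p - δ x 4 * L)
      ≡⟨ ∑-- p _ _ ⟩
    ∑[ x < p ] legendre (+ x * (+ x - + 16)) p - ∑[ x < p ] (δ x 4 * L)
      ≡⟨ cong₂ _-_ (∑-legendre-x[x-a] (+ 16) (p∤* p∤4 p∤4)) (∑-δ p 4 _ 4<p) ⟩
    -1ℤ - L
      ≡⟨ cong (_-_ -1ℤ) legendre-−3 ⟩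
    -1ℤ - legendre (+ p) 3
      ∎
    where
    open ≡-Reasoning
    L = legendre (- + 3) p
    remove-double-root : ∀ {x} → x < p →
      legendre (f (+ 1) (+ x) * f (+ 9) (+ x)) p ≡ legendre (+ x * (+ x - + 16)) p - δ x 4 * L
    remove-double-root {x} x<p = [ at-4 , away-from-4 ]′ (toSum (x ℕ.≟ 4))
      where
      at-4 : x ≡ 4 → legendre (f (+ 1) (+ x) * f (+ 9) (+ x)) p ≡ legendre (+ x * (+ x - + 16)) p - δ x 4 * L
      at-4 refl = begin
        legendre 0ℤ p                                ≡⟨ legendre-p∣ p∣0 ⟩
        0ℤ                                           ≡⟨ ℤ.+-inverseʳ L ⟨
        L - L                                        ≡⟨ cong₂ _-_ (legendre-square-* (+ 4) (- + 3) p∤4) (ℤ.*-identityˡ L) ⟨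
        legendre (+ 4 * (+ 4 - + 16)) p - 1ℤ * L     ≡⟨ cong (λ d → legendre (+ 4 * (+ 4 - + 16)) p - d * L) (δ-refl 4) ⟨
        legendre (+ 4 * (+ 4 - + 16)) p - δ 4 4 * L  ∎
      away-from-4 : x ≢ 4 → legendre (f (+ 1) (+ x) * f (+ 9) (+ x)) p ≡ legendre (+ x * (+ x - + 16)) p - δ x 4 * L
      away-from-4 x≢4 = begin
        legendre (f (+ 1) (+ x) * f (+ 9) (+ x)) p
          ≡⟨ cong (λ s → legendre s p) (f₁f₉ (+ x)) ⟩
        legendre ((+ x - + 4) * (+ x - + 4) * (+ x * (+ x - + 16))) p
          ≡⟨ legendre-square-* (+ x - + 4) _ (x≢4 ∘ <p-injective x<p 4<p) ⟩
        legendre (+ x * (+ x - + 16)) p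
          ≡⟨ ℤ.+-identityʳ _ ⟨
        legendre (+ x * (+ x - + 16)) p - 0ℤ * L
          ≡⟨ cong (λ d → legendre (+ x * (+ x - + 16)) p - d * L) (δ-≢ {x} {4} x≢4) ⟨
        legendre (+ x * (+ x - + 16)) p - δ x 4 * L
          ∎

lemma4 : (p : ℕ) → (pr : Prime p) → p ≥ 5 →
         (ε p {{prime⇒nonZero pr}} (+ 1) ≡ + (p ∸ 2))
         × (ε p {{prime⇒nonZero pr}} (+ 9) ≡ -1ℤ - legendre (+ p) 3)
lemma4 p pr p≥5 = ε₁ , ε₉
  where open Epsilon p pr p≥5
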